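{- Let $N$ be a positive integer, $\Gamma=\Gamma_0(N,3)$, $d$ a positive divisor of $N$, and $\Delta=\gcd(d,N/d)$. Let $P\subset\mathrm{SL}_3(\mathbb{Q})$ be the stabilizer of a plane such that ${}^tP=\{{}^tg:g\in P\}$ is the stabilizer of the line through ${}^t(d,1,0)$. Let $U$ be the unipotent radical of $P$, $\Gamma_P=\Gamma\cap P$, $\Gamma_U=\Gamma\cap U$, and $\Gamma_L=\Gamma_P/\Gamma_U$. Then $\Gamma_U\cong\mathbb{Z}^2$ and $\Gamma_L\cong{}^t\Gamma_1(d,\Delta)^*=\{{}^tg: g\in\Gamma_1(d,\Delta)^*\}$; in particular there is an exact sequence $1\to\Gamma_U\to\Gamma_P\to\Gamma_L\to1$ with these identifications.
   Context: $\Gamma_0(N,3)$ is the group of matrices in $\mathrm{SL}_3(\mathbb{Z})$ whose $(2,1)$ and $(3,1)$ entries are divisible by $N$. For positive integers $M,\Delta$ with $\Delta\mid M$, $\Gamma_1(M,\Delta)^*=\{g=\begin{bmatrix}a&b\\c&D\end{bmatrix}\in\mathrm{GL}_2(\mathbb{Z}) : c\equiv 0\pmod M,\ a\equiv\det(g)\pmod\Delta\}$. -}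

module Defs where

open import Data.Nat as ℕ using (ℕ; NonZero)
open import Data.Nat.DivMod using (_/_)
open import Data.Nat.GCD using (gcd)
open import Data.Fin using (Fin; zero; suc)
open import Data.Integer as ℤ using (ℤ; +_; _-_; _*_; _+_; -_)
open import Data.Integer.Divisibility as ℤD using ()
open import Data.Rational as ℚ using (ℚ)
open import Data.Product using (Σ; _×_; _,_; ∃)
open import Data.Sum using (_⊎_)
open import Relation.Binary.PropositionalEquality using (_≡_)

-- Integer matrices, as functions  Fin n → Fin n → ℤ  (row, column).
-- Entry (i,j) of the paper (1-based) is  g (i-1) (j-1).

Mat : ℕ → Set
Mat n = Fin n → Fin n → ℤ

Vec3 : Set
Vec3 = Fin 3 → ℤ

Vec3ℚ : Set
Vec3ℚ = Fin 3 → ℚ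

f0 f1 f2 : Fin 3
f0 = zero
f1 = suc zero
f2 = suc (suc zero)

g0 g1 : Fin 2
g0 = zero
g1 = suc zero

_≈M_ : ∀ {n} → Mat n → Mat n → Set
_≈M_ {n} g h = (i j : Fin n) → g i j ≡ h i j

transpose : ∀ {n} → Mat n → Mat n
transpose g i j = g j i

_⊗₃_ : Mat 3 → Mat 3 → Mat 3
(g ⊗₃ h) i j = g i f0 * h f0 j + g i f1 * h f1 j + g i f2 * h f2 j

_⊗₂_ : Mat 2 → Mat 2 → Mat 2
(g ⊗₂ h) i j = g i g0 * h g0 j + g i g1 * h g1 j

det₃ : Mat 3 → ℤ
det₃ g =
    g f0 f0 * (g f1 f1 * g f2 f2 - g f1 f2 * g f2 f1)
  - g f0 f1 * (g f1 f0 * g f2 f2 - g f1 f2 * g f2 f0)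
  + g f0 f2 * (g f1 f0 * g f2 f1 - g f1 f1 * g f2 f0)

det₂ : Mat 2 → ℤ
det₂ g = g g0 g0 * g g1 g1 - g g0 g1 * g g1 g0

Γ₀3 : ℕ → Mat 3 → Set
Γ₀3 N g = det₃ g ≡ + 1 × ((+ N) ℤD.∣ g f1 f0) × ((+ N) ℤD.∣ g f2 f0)

GL₂ℤ : Mat 2 → Set
GL₂ℤ g = (det₂ g ≡ + 1) ⊎ (det₂ g ≡ - (+ 1))

Γ₁* : ℕ → ℕ → Mat 2 → Set
Γ₁* M Δ g = GL₂ℤ g × ((+ M) ℤD.∣ g g1 g0) × ((+ Δ) ℤD.∣ (g g0 g0 - det₂ g))

tΓ₁* : ℕ → ℕ → Mat 2 → Set
tΓ₁* M Δ k = Γ₁* M Δ (transpose k)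

toℚ : ℤ → ℚ
toℚ z = z ℚ./ 1

act : Mat 3 → Vec3ℚ → Vec3ℚ
act g x i = toℚ (g i f0) ℚ.* x f0 ℚ.+ toℚ (g i f1) ℚ.* x f1 ℚ.+ toℚ (g i f2) ℚ.* x f2

vd : ℕ → Vec3ℚ
vd d zero = toℚ (+ d)
vd d (suc zero) = toℚ (+ 1)
vd d (suc (suc zero)) = toℚ (+ 0)

inP : ℕ → Mat 3 → Set
inP d g = det₃ g ≡ + 1 × ∃ λ (c : ℚ) → (i : Fin 3) → act (transpose g) (vd d) i ≡ c ℚ.* vd d i

-- The plane W stabilised by P:  W = v^⊥ = { x : d x₁ + x₂ = 0 }
-- (indeed ᵗP = Stab(ℚv) iff P = Stab(v^⊥)).
inW : ℕ → Vec3ℚ → Set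
inW d x = vd d f0 ℚ.* x f0 ℚ.+ vd d f1 ℚ.* x f1 ℚ.+ vd d f2 ℚ.* x f2 ≡ ℚ.0ℚ

-- Unipotent radical U of P: elements of P acting trivially on W and on ℚ³/W.
inU : ℕ → Mat 3 → Set
inU d g = inP d g
        × ((w : Vec3ℚ) → inW d w → (i : Fin 3) → act g w i ≡ w i)
        × ((x : Vec3ℚ) → inW d (λ i → act g x i ℚ.- x i))

ΓP : ℕ → ℕ → Mat 3 → Set
ΓP N d g = Γ₀3 N g × inP d g

ΓU : ℕ → ℕ → Mat 3 → Set
ΓU N d g = Γ₀3 N g × inU d g

I₂ : Mat 2
I₂ zero zero = + 1
I₂ (suc zero) (suc zero) = + 1
I₂ zero (suc zero) = + 0
I₂ (suc zero) zero = + 0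

GammaU≅ℤ² : ℕ → ℕ → Set
GammaU≅ℤ² N d =
  Σ (ℤ × ℤ → Mat 3) λ ι →
      ((a b : ℤ × ℤ) → ι (addℤ² a b) ≈M (ι a ⊗₃ ι b))
    × ((a : ℤ × ℤ) → ΓU N d (ι a))
    × ((a b : ℤ × ℤ) → ι a ≈M ι b → a ≡ b)
    × ((g : Mat 3) → ΓU N d g → ∃ λ a → ι a ≈M g)
  where
  addℤ² : ℤ × ℤ → ℤ × ℤ → ℤ × ℤ
  addℤ² (a , b) (c , e) = (a + c , b + e)

-- Exact sequence 1 → Γ_U → Γ_P → ᵗΓ₁(d,Δ)^* → 1:
-- a homomorphism φ : Γ_P → ᵗΓ₁(d,Δ)^* which is surjective with kernel Γ_U
-- (equivalently, by the first isomorphism theorem, Γ_L = Γ_P/Γ_U ≅ ᵗΓ₁(d,Δ)^*).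
GammaL≅tΓ₁* : ℕ → ℕ → ℕ → Set
GammaL≅tΓ₁* N d Δ =
  Σ (Mat 3 → Mat 2) λ φ →
      ((g h : Mat 3) → ΓP N d g → g ≈M h → φ g ≈M φ h)
    × ((g h : Mat 3) → ΓP N d g → ΓP N d h → φ (g ⊗₃ h) ≈M (φ g ⊗₂ φ h))
    × ((g : Mat 3) → ΓP N d g → tΓ₁* d Δ (φ g))
    × ((k : Mat 2) → tΓ₁* d Δ k → ∃ λ g → ΓP N d g × φ g ≈M k)
    × ((g : Mat 3) → ΓP N d g → (φ g ≈M I₂ → ΓU N d g) × (ΓU N d g → φ g ≈M I₂))

-- Write v = ᵗ(d,1,0). A matrix g lies in P iff ᵗg v = χ(g) v, which in integer terms pins down
-- g₁₀ = d(χ(g) - g₀₀) and g₁₂ = -d g₀₂; then det g = χ(g) · det A(g), where A(g) is the matrix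
-- of g on the plane v^⊥ in the basis ᵗ(1,-d,0), ᵗ(0,0,1). On Γ_P this forces χ(g) = det A(g) = ±1,
-- so g ↦ χ(g) ᵗadj A(g) = ᵗA(g)⁻¹ is a homomorphism. Its kernel U consists of the matrices with
-- χ = 1 and A = I, i.e. the transvections I + u ᵗv with u = ᵗ(α,-dα,β); such a matrix is in
-- Γ₀(N,3) iff N ∣ d²α and N ∣ dβ, i.e. N/gcd(N,d²) ∣ α and N/d ∣ β, which gives Γ_U ≅ ℤ².
-- On the image side, N ∣ g₂₀ gives d ∣ k₀₁, and N ∣ g₁₀ = d(χ - g₀₀) gives k₀₀ ≡ det k mod Δ;
-- conversely a Bézout relation Δ = u d + w (N/d) lets every k ∈ ᵗΓ₁(d,Δ)* be lifted to Γ_P.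

module Submission where

open import Defs
open import Data.Nat using (ℕ; NonZero; _<_)
open import Data.Nat.Divisibility using (_∣_)
open import Data.Nat.DivMod using (_/_)
open import Data.Nat.GCD using (gcd)
open import Data.Product using (_×_)

import Data.Nat as ℕ
import Data.Nat.Properties as ℕP
import Data.Nat.Divisibility as ℕD
open import Data.Nat.DivMod using (m*[n/m]≡n; m≥n⇒m/n>0)
open import Data.Nat.GCD using (gcd[m,n]∣m; gcd[m,n]∣n; gcd[m,n]≢0; m/gcd[m,n]≢0; gcd-GCD; module Bézout)
open import Data.Nat.Coprimality using (coprime-/gcd; coprime-divisor; 1-coprimeTo) renaming (sym to coprime-sym)
open import Data.Fin using (zero; suc)
open import Data.Integer using (ℤ; +_; +[1+_]; -[1+_]; _+_; _*_; _-_; -_; ∣_∣)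
import Data.Integer.Properties as ℤP
import Data.Integer.Divisibility as ℤD
open import Data.Integer.Divisibility.Signed
  using (divides; ∣ᵤ⇒∣; ∣⇒∣ᵤ; ∣-refl; ∣-trans; ∣m∣n⇒∣m+n; ∣m∣n⇒∣m-n; ∣m⇒∣-m; ∣n⇒∣m*n; ∣m⇒∣m*n)
  renaming (_∣_ to _∣ℤ_)
open import Data.Integer.Tactic.RingSolver using (solve)
open import Data.List using (_∷_; [])
open import Data.Rational as ℚ using (ℚ; mkℚ; 0ℚ; 1ℚ)
import Data.Rational.Properties as ℚP
open import Data.Rational.Solver using (module +-*-Solver)
open import Data.Product using (∃; ∃₂; _,_; proj₁; proj₂)
open import Data.Sum using (_⊎_; inj₁; inj₂)
open import Function using (_∘_)
open import Relation.Binary.PropositionalEquality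
open ≡-Reasoning

IsUnit : ℤ → Set
IsUnit ε = ε ≡ + 1 ⊎ ε ≡ - + 1

∣i∣≡1⇒unit : ∀ i → ∣ i ∣ ≡ 1 → IsUnit i
∣i∣≡1⇒unit +[1+ 0 ] _ = inj₁ refl
∣i∣≡1⇒unit -[1+ 0 ] _ = inj₂ refl
∣i∣≡1⇒unit (+ 0) ()
∣i∣≡1⇒unit +[1+ ℕ.suc n ] ()
∣i∣≡1⇒unit -[1+ ℕ.suc n ] ()

unit-square : ∀ {ε} → IsUnit ε → ε * ε ≡ + 1
unit-square (inj₁ refl) = refl
unit-square (inj₂ refl) = refl

i*j≡1⇒i≡j∧unit : ∀ i j → i * j ≡ + 1 → i ≡ j × IsUnit i
i*j≡1⇒i≡j∧unit i j ij≡1 =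
  equalUnits (∣i∣≡1⇒unit i (ℕP.m*n≡1⇒m≡1 ∣ i ∣ ∣ j ∣ ∣i∣∣j∣≡1)) (∣i∣≡1⇒unit j (ℕP.m*n≡1⇒n≡1 ∣ i ∣ ∣ j ∣ ∣i∣∣j∣≡1)) ij≡1
  where
  ∣i∣∣j∣≡1 : ∣ i ∣ ℕ.* ∣ j ∣ ≡ 1
  ∣i∣∣j∣≡1 = trans (sym (ℤP.abs-* i j)) (cong ∣_∣ ij≡1)
  equalUnits : ∀ {x y} → IsUnit x → IsUnit y → x * y ≡ + 1 → x ≡ y × IsUnit x
  equalUnits (inj₁ refl) (inj₁ refl) _ = refl , inj₁ refl
  equalUnits (inj₂ refl) (inj₂ refl) _ = refl , inj₂ refl
  equalUnits (inj₁ refl) (inj₂ refl) ()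
  equalUnits (inj₂ refl) (inj₁ refl) ()

≡-by-difference : ∀ {p q x y : ℤ} → p ≡ q → x ≡ y + (p - q) → x ≡ y
≡-by-difference {p} {y = y} refl x≡y+0 =
  trans x≡y+0 (trans (cong (_+_ y) (ℤP.+-inverseʳ p)) (ℤP.+-identityʳ y))

m-n≡o⇒m≡o+n : ∀ {m n o : ℤ} → m - n ≡ o → m ≡ o + n
m-n≡o⇒m≡o+n {m} {n} refl = solve (m ∷ n ∷ [])

m+n≡o⇒m≡o-n : ∀ {m n o : ℤ} → m + n ≡ o → m ≡ o - n
m+n≡o⇒m≡o-n {m} {n} refl = solve (m ∷ n ∷ [])

m+n≡o⇒n≡o-m : ∀ {m n o : ℤ} → m + n ≡ o → n ≡ o - m
m+n≡o⇒n≡o-m {m} {n} refl = solve (m ∷ n ∷ [])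

m+n-n≡m : ∀ m n → m + n - n ≡ m
m+n-n≡m m n = solve (m ∷ n ∷ [])

∣m*a⇒n/gcd∣a : ∀ n m a .{{_ : NonZero (gcd n m)}} → n ∣ m ℕ.* a → n / gcd n m ∣ a
∣m*a⇒n/gcd∣a n m a n∣ma = coprime-divisor (coprime-/gcd n m)
  (ℕD.*-cancelˡ-∣ (gcd n m) (subst₂ _∣_ (sym (m*[n/m]≡n (gcd[m,n]∣m n m))) (factor-gcd n m a) n∣ma))
  where
  factor-gcd : ∀ n m a .{{_ : NonZero (gcd n m)}} → m ℕ.* a ≡ gcd n m ℕ.* (m / gcd n m ℕ.* a)
  factor-gcd n m a = trans (cong (ℕ._* a) (sym (m*[n/m]≡n (gcd[m,n]∣n n m)))) (ℕP.*-assoc (gcd n m) _ a)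

n/gcd∣a⇒∣m*a : ∀ n m a .{{_ : NonZero (gcd n m)}} → n / gcd n m ∣ a → n ∣ m ℕ.* a
n/gcd∣a⇒∣m*a n m a A∣a = subst₂ _∣_ (m*[n/m]≡n (gcd[m,n]∣m n m)) (sym factor-gcd)
  (ℕD.*-monoʳ-∣ (gcd n m) (ℕD.∣n⇒∣m*n (m / gcd n m) A∣a))
  where
  factor-gcd : m ℕ.* a ≡ gcd n m ℕ.* (m / gcd n m ℕ.* a)
  factor-gcd = trans (cong (ℕ._* a) (sym (m*[n/m]≡n (gcd[m,n]∣n n m)))) (ℕP.*-assoc (gcd n m) _ a)

bézout : ∀ m n → ∃₂ λ u w → + gcd m n ≡ u * + m + w * + n
bézout m n = fromIdentity (Bézout.identity (gcd-GCD m n))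
  where
  lift : ∀ g a b c e → g ℕ.+ a ℕ.* b ≡ c ℕ.* e → + g ≡ + c * + e - + a * + b
  lift g a b c e eq = m+n≡o⇒m≡o-n (begin
    + g + + a * + b     ≡⟨ cong (_+_ (+ g)) (ℤP.pos-* a b) ⟨
    + g + + (a ℕ.* b)   ≡⟨ ℤP.pos-+ g (a ℕ.* b) ⟨
    + (g ℕ.+ a ℕ.* b)   ≡⟨ cong +_ eq ⟩
    + (c ℕ.* e)         ≡⟨ ℤP.pos-* c e ⟩
    + c * + e           ∎)
  fromIdentity : Bézout.Identity (gcd m n) m n → ∃₂ λ u w → + gcd m n ≡ u * + m + w * + n
  fromIdentity (Bézout.+- x y eq) = + x , - + y , trans (lift (gcd m n) y n x m eq) (rearrange (+ y) (+ n) (+ x) (+ m))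
    where
    rearrange : ∀ a b c e → c * e - a * b ≡ c * e + (- a) * b
    rearrange a b c e = solve (a ∷ b ∷ c ∷ e ∷ [])
  fromIdentity (Bézout.-+ x y eq) = - + x , + y , trans (lift (gcd m n) x m y n eq) (rearrange (+ x) (+ m) (+ y) (+ n))
    where
    rearrange : ∀ a b c e → c * e - a * b ≡ (- a) * b + c * e
    rearrange a b c e = solve (a ∷ b ∷ c ∷ e ∷ [])

toℚ-mkℚ : ∀ z → toℚ z ≡ mkℚ z 0 (coprime-sym (1-coprimeTo ∣ z ∣))
toℚ-mkℚ z = ℚP.↥p/↧p≡p (mkℚ z 0 (coprime-sym (1-coprimeTo ∣ z ∣)))

toℚ-* : ∀ a b → toℚ (a * b) ≡ toℚ a ℚ.* toℚ b
toℚ-* a b = sym (cong₂ ℚ._*_ (toℚ-mkℚ a) (toℚ-mkℚ b))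

toℚ-+ : ∀ a b → toℚ (a + b) ≡ toℚ a ℚ.+ toℚ b
toℚ-+ a b = sym (trans (cong₂ ℚ._+_ (toℚ-mkℚ a) (toℚ-mkℚ b))
  (cong (ℚ._/ 1) (cong₂ _+_ (ℤP.*-identityʳ a) (ℤP.*-identityʳ b))))

toℚ-neg : ∀ a → toℚ (- a) ≡ ℚ.- toℚ a
toℚ-neg a = trans (toℚ-mkℚ (- a)) (trans (mkℚ-neg a) (cong ℚ.-_ (sym (toℚ-mkℚ a))))
  where
  mkℚ-neg : ∀ a → mkℚ (- a) 0 (coprime-sym (1-coprimeTo ∣ - a ∣)) ≡ ℚ.- mkℚ a 0 (coprime-sym (1-coprimeTo ∣ a ∣))
  mkℚ-neg (+ 0) = refl
  mkℚ-neg +[1+ n ] = refl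
  mkℚ-neg -[1+ n ] = refl

toℚ-- : ∀ a b → toℚ (a - b) ≡ toℚ a ℚ.- toℚ b
toℚ-- a b = trans (toℚ-+ a (- b)) (cong (toℚ a ℚ.+_) (toℚ-neg b))

toℚ-injective : ∀ {a b} → toℚ a ≡ toℚ b → a ≡ b
toℚ-injective {a} {b} eq = cong ℚ.↥_ (trans (sym (toℚ-mkℚ a)) (trans eq (toℚ-mkℚ b)))

vec3 : ℤ → ℤ → ℤ → Vec3
vec3 a b c zero = a
vec3 a b c (suc zero) = b
vec3 a b c (suc (suc zero)) = c

infix 8 _·_
_·_ : Vec3 → Vec3 → ℤ
u · w = u f0 * w f0 + u f1 * w f1 + u f2 * w f2

toℚ-· : ∀ u w → toℚ (u · w) ≡ toℚ (u f0) ℚ.* toℚ (w f0) ℚ.+ toℚ (u f1) ℚ.* toℚ (w f1) ℚ.+ toℚ (u f2) ℚ.* toℚ (w f2)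
toℚ-· u w = trans (toℚ-+ (u f0 * w f0 + u f1 * w f1) (u f2 * w f2))
  (cong₂ ℚ._+_ (trans (toℚ-+ (u f0 * w f0) (u f1 * w f1)) (cong₂ ℚ._+_ (toℚ-* (u f0) (w f0)) (toℚ-* (u f1) (w f1))))
               (toℚ-* (u f2) (w f2)))

act-toℚ : ∀ g w i → act g (toℚ ∘ w) i ≡ toℚ (g i · w)
act-toℚ g w i = sym (toℚ-· (g i) w)

act-cong : ∀ {g h} → g ≈M h → ∀ x i → act g x i ≡ act h x i
act-cong {g} {h} g≈h x i = cong₂ ℚ._+_ (cong₂ ℚ._+_ (entry f0) (entry f1)) (entry f2)
  where
  entry : ∀ j → toℚ (g i j) ℚ.* x j ≡ toℚ (h i j) ℚ.* x j
  entry j = cong (λ t → toℚ t ℚ.* x j) (g≈h i j)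

proportional⇒integral-multiple : ∀ (w u : Vec3) c → u f1 ≡ + 1 →
  (∀ i → toℚ (w i) ≡ c ℚ.* toℚ (u i)) → ∀ i → w i ≡ w f1 * u i
proportional⇒integral-multiple w u c u₁≡1 w≡cu i = toℚ-injective (begin
  toℚ (w i)                 ≡⟨ w≡cu i ⟩
  c ℚ.* toℚ (u i)           ≡⟨ cong (ℚ._* toℚ (u i)) c≡w₁ ⟩
  toℚ (w f1) ℚ.* toℚ (u i)  ≡⟨ toℚ-* (w f1) (u i) ⟨
  toℚ (w f1 * u i)          ∎)
  where
  c≡w₁ : c ≡ toℚ (w f1)
  c≡w₁ = sym (trans (w≡cu f1) (trans (cong (λ t → c ℚ.* toℚ t) u₁≡1) (ℚP.*-identityʳ c)))

infix 7 _·₂_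
_·₂_ : ℤ → Mat 2 → Mat 2
(a ·₂ X) i j = a * X i j

-- The transposed adjugate: for det X = ±1, (det X) ·₂ cofactor X is the inverse transpose of X.
cofactor : Mat 2 → Mat 2
cofactor X zero zero = X g1 g1
cofactor X zero (suc zero) = - X g1 g0
cofactor X (suc zero) zero = - X g0 g1
cofactor X (suc zero) (suc zero) = X g0 g0

det₂-cong : ∀ {X Y} → X ≈M Y → det₂ X ≡ det₂ Y
det₂-cong X≈Y = cong₂ _-_ (cong₂ _*_ (X≈Y g0 g0) (X≈Y g1 g1)) (cong₂ _*_ (X≈Y g0 g1) (X≈Y g1 g0))

det₂-transpose : ∀ X → det₂ (transpose X) ≡ det₂ X
det₂-transpose X = cong (_-_ (X g0 g0 * X g1 g1)) (ℤP.*-comm (X g1 g0) (X g0 g1))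

det₂-·₂ : ∀ a X → det₂ (a ·₂ X) ≡ (a * a) * det₂ X
det₂-·₂ a X = expand (X g0 g0) (X g0 g1) (X g1 g0) (X g1 g1)
  where
  expand : ∀ x y z w → (a * x) * (a * w) - (a * y) * (a * z) ≡ (a * a) * (x * w - y * z)
  expand x y z w = solve (a ∷ x ∷ y ∷ z ∷ w ∷ [])

det₂-cofactor : ∀ X → det₂ (cofactor X) ≡ det₂ X
det₂-cofactor X = expand (X g0 g0) (X g0 g1) (X g1 g0) (X g1 g1)
  where
  expand : ∀ x y z w → w * x - (- z) * (- y) ≡ x * w - y * z
  expand x y z w = solve (x ∷ y ∷ z ∷ w ∷ [])

cofactor-cong : ∀ {X Y} → X ≈M Y → cofactor X ≈M cofactor Y
cofactor-cong X≈Y zero zero = X≈Y g1 g1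
cofactor-cong X≈Y zero (suc zero) = cong -_ (X≈Y g1 g0)
cofactor-cong X≈Y (suc zero) zero = cong -_ (X≈Y g0 g1)
cofactor-cong X≈Y (suc zero) (suc zero) = X≈Y g0 g0

cofactor-I₂ : cofactor I₂ ≈M I₂
cofactor-I₂ zero zero = refl
cofactor-I₂ zero (suc zero) = refl
cofactor-I₂ (suc zero) zero = refl
cofactor-I₂ (suc zero) (suc zero) = refl

cofactor-involutive : ∀ X → cofactor (cofactor X) ≈M X
cofactor-involutive X zero zero = refl
cofactor-involutive X zero (suc zero) = ℤP.neg-involutive (X g0 g1)
cofactor-involutive X (suc zero) zero = ℤP.neg-involutive (X g1 g0)
cofactor-involutive X (suc zero) (suc zero) = refl

cofactor-·₂ : ∀ a X → cofactor (a ·₂ X) ≈M (a ·₂ cofactor X)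
cofactor-·₂ a X zero zero = refl
cofactor-·₂ a X zero (suc zero) = ℤP.neg-distribʳ-* a (X g1 g0)
cofactor-·₂ a X (suc zero) zero = ℤP.neg-distribʳ-* a (X g0 g1)
cofactor-·₂ a X (suc zero) (suc zero) = refl

cofactor-⊗₂ : ∀ X Y → cofactor (X ⊗₂ Y) ≈M (cofactor X ⊗₂ cofactor Y)
cofactor-⊗₂ X Y = entry
  where
  diagonal : ∀ a b c e → a * b + c * e ≡ c * e + (- a) * (- b)
  diagonal a b c e = solve (a ∷ b ∷ c ∷ e ∷ [])
  diagonal′ : ∀ a b c e → a * b + c * e ≡ (- c) * (- e) + a * b
  diagonal′ a b c e = solve (a ∷ b ∷ c ∷ e ∷ [])
  offDiagonal : ∀ a b c e → - (a * b + c * e) ≡ c * (- e) + (- a) * b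
  offDiagonal a b c e = solve (a ∷ b ∷ c ∷ e ∷ [])
  offDiagonal′ : ∀ a b c e → - (a * b + c * e) ≡ (- c) * e + a * (- b)
  offDiagonal′ a b c e = solve (a ∷ b ∷ c ∷ e ∷ [])
  entry : cofactor (X ⊗₂ Y) ≈M (cofactor X ⊗₂ cofactor Y)
  entry zero zero = diagonal (X g1 g0) (Y g0 g1) (X g1 g1) (Y g1 g1)
  entry zero (suc zero) = offDiagonal (X g1 g0) (Y g0 g0) (X g1 g1) (Y g1 g0)
  entry (suc zero) zero = offDiagonal′ (X g0 g0) (Y g0 g1) (X g0 g1) (Y g1 g1)
  entry (suc zero) (suc zero) = diagonal′ (X g0 g0) (Y g0 g0) (X g0 g1) (Y g1 g0)

·₂-⊗₂ : ∀ a b X Y → ((a * b) ·₂ (X ⊗₂ Y)) ≈M ((a ·₂ X) ⊗₂ (b ·₂ Y))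
·₂-⊗₂ a b X Y i j = expand (X i g0) (Y g0 j) (X i g1) (Y g1 j)
  where
  expand : ∀ x y z w → (a * b) * (x * y + z * w) ≡ (a * x) * (b * y) + (a * z) * (b * w)
  expand x y z w = solve (a ∷ b ∷ x ∷ y ∷ z ∷ w ∷ [])

unit-·₂-·₂ : ∀ {ε} → ε * ε ≡ + 1 → ∀ X → (ε ·₂ (ε ·₂ X)) ≈M X
unit-·₂-·₂ {ε} ε²≡1 X i j = begin
  ε * (ε * X i j)  ≡⟨ ℤP.*-assoc ε ε (X i j) ⟨
  (ε * ε) * X i j  ≡⟨ cong (_* X i j) ε²≡1 ⟩
  + 1 * X i j      ≡⟨ ℤP.*-identityˡ (X i j) ⟩
  X i j            ∎

module Parabolic (D : ℤ) where

  v w₁ w₂ e₂ : Vec3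
  v = vec3 D (+ 1) (+ 0)
  w₁ = vec3 (+ 1) (- D) (+ 0)
  w₂ = vec3 (+ 0) (+ 0) (+ 1)
  e₂ = vec3 (+ 0) (+ 1) (+ 0)

  v·w₁≡0 : v · w₁ ≡ + 0
  v·w₁≡0 = cancel
    where
    cancel : D * + 1 + + 1 * (- D) + + 0 * + 0 ≡ + 0
    cancel = solve (D ∷ [])

  v·w₂≡0 : v · w₂ ≡ + 0
  v·w₂≡0 = cancel
    where
    cancel : D * + 0 + + 1 * + 0 + + 0 * + 1 ≡ + 0
    cancel = solve (D ∷ [])

  ·w₁ : ∀ u → u · w₁ ≡ u f0 - D * u f1
  ·w₁ u = expand (u f0) (u f1) (u f2)
    where
    expand : ∀ a b c → a * + 1 + b * (- D) + c * + 0 ≡ a - D * b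
    expand a b c = solve (D ∷ a ∷ b ∷ c ∷ [])

  ·w₂ : ∀ u → u · w₂ ≡ u f2
  ·w₂ u = expand (u f0) (u f1) (u f2)
    where
    expand : ∀ a b c → a * + 0 + b * + 0 + c * + 1 ≡ c
    expand a b c = solve (a ∷ b ∷ c ∷ [])

  ·e₂ : ∀ u → u · e₂ ≡ u f1
  ·e₂ u = expand (u f0) (u f1) (u f2)
    where
    expand : ∀ a b c → a * + 0 + b * + 1 + c * + 0 ≡ b
    expand a b c = solve (a ∷ b ∷ c ∷ [])

  -- For g ∈ P, χ g is the eigenvalue of ᵗg on v.
  χ : Mat 3 → ℤ
  χ g = D * g f0 f1 + g f1 f1

  -- The matrix of g on the plane v · x = 0 in the basis w₁, w₂ (cf. block-columns).
  block : Mat 3 → Mat 2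
  block g zero zero = g f0 f0 - D * g f0 f1
  block g zero (suc zero) = g f0 f2
  block g (suc zero) zero = g f2 f0 - D * g f2 f1
  block g (suc zero) (suc zero) = g f2 f2

  block-columns : ∀ g → (g f0 · w₁ ≡ block g g0 g0 × g f2 · w₁ ≡ block g g1 g0)
                      × (g f0 · w₂ ≡ block g g0 g1 × g f2 · w₂ ≡ block g g1 g1)
  block-columns g = (·w₁ (g f0) , ·w₁ (g f2)) , (·w₂ (g f0) , ·w₂ (g f2))

  v·[ge₂-e₂]≡0⇒χ≡1 : ∀ g → v · (λ i → g i f1 - e₂ i) ≡ + 0 → χ g ≡ + 1
  v·[ge₂-e₂]≡0⇒χ≡1 g = collect (g f0 f1) (g f1 f1) (g f2 f1)
    where
    collect : ∀ b f l → D * (b - + 0) + + 1 * (f - + 1) + + 0 * (l - + 0) ≡ + 0 → D * b + f ≡ + 1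
    collect b f l eq = ≡-by-difference eq (solve (D ∷ b ∷ f ∷ l ∷ []))

  ParabolicShape : Mat 3 → Set
  ParabolicShape g = g f1 f0 ≡ D * (χ g - g f0 f0) × g f1 f2 ≡ - (D * g f0 f2)

  transpose-column₁ : ∀ g → transpose g f1 · v ≡ χ g
  transpose-column₁ g = expand (g f0 f1) (g f1 f1) (g f2 f1)
    where
    expand : ∀ a b c → a * D + b * + 1 + c * + 0 ≡ D * a + b
    expand a b c = solve (D ∷ a ∷ b ∷ c ∷ [])

  shape⇒eigen : ∀ g → ParabolicShape g → ∀ i → transpose g i · v ≡ χ g * v i
  shape⇒eigen g (g₁₀≡ , _) zero = column₀ (g f0 f0) (g f0 f1) (g f1 f1) (g f2 f0) g₁₀≡
    where
    column₀ : ∀ a b c e {x} → x ≡ D * (D * b + c - a) → a * D + x * + 1 + e * + 0 ≡ (D * b + c) * D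
    column₀ a b c e refl = solve (D ∷ a ∷ b ∷ c ∷ e ∷ [])
  shape⇒eigen g _ (suc zero) = trans (transpose-column₁ g) (sym (ℤP.*-identityʳ (χ g)))
  shape⇒eigen g (_ , g₁₂≡) (suc (suc zero)) = column₂ (g f0 f2) (g f2 f2) (χ g) g₁₂≡
    where
    column₂ : ∀ a c k {x} → x ≡ - (D * a) → a * D + x * + 1 + c * + 0 ≡ k * + 0
    column₂ a c k refl = solve (D ∷ a ∷ c ∷ k ∷ [])

  eigen⇒shape : ∀ g → (∀ i → transpose g i · v ≡ χ g * v i) → ParabolicShape g
  eigen⇒shape g eigen =
      column₀ (g f0 f0) (g f0 f1) (g f1 f0) (g f1 f1) (g f2 f0) (eigen f0)
    , column₂ (g f0 f2) (g f1 f2) (g f2 f2) (χ g) (eigen f2)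
    where
    column₀ : ∀ a b x c e → a * D + x * + 1 + e * + 0 ≡ (D * b + c) * D → x ≡ D * (D * b + c - a)
    column₀ a b x c e eq = ≡-by-difference eq (solve (D ∷ a ∷ b ∷ x ∷ c ∷ e ∷ []))
    column₂ : ∀ a x c k → a * D + x * + 1 + c * + 0 ≡ k * + 0 → x ≡ - (D * a)
    column₂ a x c k eq = ≡-by-difference eq (solve (D ∷ a ∷ x ∷ c ∷ k ∷ []))

  det₃-shape : ∀ g → ParabolicShape g → det₃ g ≡ χ g * det₂ (block g)
  det₃-shape g (g₁₀≡ , g₁₂≡) =
    expand (g f0 f0) (g f0 f1) (g f0 f2) (g f1 f1) (g f2 f0) (g f2 f1) (g f2 f2) g₁₀≡ g₁₂≡
    where
    expand : ∀ a b c e h k l {x y} → x ≡ D * (D * b + e - a) → y ≡ - (D * c) →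
             a * (e * l - y * k) - b * (x * l - y * h) + c * (x * k - e * h)
             ≡ (D * b + e) * ((a - D * b) * l - c * (h - D * k))
    expand a b c e h k l refl refl = solve (D ∷ a ∷ b ∷ c ∷ e ∷ h ∷ k ∷ l ∷ [])

  χ-unit : ∀ g → ParabolicShape g → det₃ g ≡ + 1 → χ g ≡ det₂ (block g) × IsUnit (χ g)
  χ-unit g shape det≡1 = i*j≡1⇒i≡j∧unit (χ g) (det₂ (block g)) (trans (sym (det₃-shape g shape)) det≡1)

  χ-⊗₃ : ∀ g h → ParabolicShape g → χ (g ⊗₃ h) ≡ χ g * χ h
  χ-⊗₃ g h (g₁₀≡ , g₁₂≡) =
    expand (g f0 f0) (g f0 f1) (g f0 f2) (g f1 f1) (h f0 f1) (h f1 f1) (h f2 f1) g₁₀≡ g₁₂≡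
    where
    expand : ∀ a b c e p q r {x y} → x ≡ D * (D * b + e - a) → y ≡ - (D * c) →
             D * (a * p + b * q + c * r) + (x * p + e * q + y * r) ≡ (D * b + e) * (D * p + q)
    expand a b c e p q r refl refl = solve (D ∷ a ∷ b ∷ c ∷ e ∷ p ∷ q ∷ r ∷ [])

  block-⊗₃ : ∀ g h → ParabolicShape h → block (g ⊗₃ h) ≈M (block g ⊗₂ block h)
  block-⊗₃ g h (h₁₀≡ , h₁₂≡) = entry
    where
    column₀ : ∀ a b c p q r s t {x} → x ≡ D * (D * q + r - p) →
              (a * p + b * x + c * s) - D * (a * q + b * r + c * t) ≡ (a - D * b) * (p - D * q) + c * (s - D * t)
    column₀ a b c p q r s t refl = solve (D ∷ a ∷ b ∷ c ∷ p ∷ q ∷ r ∷ s ∷ t ∷ [])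
    column₁ : ∀ a b c p r {y} → y ≡ - (D * p) → a * p + b * y + c * r ≡ (a - D * b) * p + c * r
    column₁ a b c p r refl = solve (D ∷ a ∷ b ∷ c ∷ p ∷ r ∷ [])
    entry : block (g ⊗₃ h) ≈M (block g ⊗₂ block h)
    entry zero zero =
      column₀ (g f0 f0) (g f0 f1) (g f0 f2) (h f0 f0) (h f0 f1) (h f1 f1) (h f2 f0) (h f2 f1) h₁₀≡
    entry zero (suc zero) = column₁ (g f0 f0) (g f0 f1) (g f0 f2) (h f0 f2) (h f2 f2) h₁₂≡
    entry (suc zero) zero =
      column₀ (g f2 f0) (g f2 f1) (g f2 f2) (h f0 f0) (h f0 f1) (h f1 f1) (h f2 f0) (h f2 f1) h₁₀≡
    entry (suc zero) (suc zero) = column₁ (g f2 f0) (g f2 f1) (g f2 f2) (h f0 f2) (h f2 f2) h₁₂≡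

  χ-cong : ∀ {g h} → g ≈M h → χ g ≡ χ h
  χ-cong g≈h = cong₂ _+_ (cong (D *_) (g≈h f0 f1)) (g≈h f1 f1)

  block-cong : ∀ {g h} → g ≈M h → block g ≈M block h
  block-cong g≈h zero zero = cong₂ _-_ (g≈h f0 f0) (cong (D *_) (g≈h f0 f1))
  block-cong g≈h zero (suc zero) = g≈h f0 f2
  block-cong g≈h (suc zero) zero = cong₂ _-_ (g≈h f2 f0) (cong (D *_) (g≈h f2 f1))
  block-cong g≈h (suc zero) (suc zero) = g≈h f2 f2

  χg₂₂-det₂-block : ∀ g → χ g * g f2 f2 - det₂ (block g)
    ≡ (χ g - g f0 f0) * g f2 f2 + D * (g f0 f1 * g f2 f2 - g f0 f2 * g f2 f1) + g f0 f2 * g f2 f0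
  χg₂₂-det₂-block g = expand (χ g) (g f0 f0) (g f0 f1) (g f0 f2) (g f2 f0) (g f2 f1) (g f2 f2)
    where
    expand : ∀ c a b e h k l → c * l - ((a - D * b) * l - e * (h - D * k)) ≡ (c - a) * l + D * (b * l - e * k) + e * h
    expand c a b e h k l = solve (D ∷ c ∷ a ∷ b ∷ e ∷ h ∷ k ∷ l ∷ [])

  levi : Mat 3 → Mat 2
  levi g = χ g ·₂ cofactor (block g)

  levi-cong : ∀ {g h} → g ≈M h → levi g ≈M levi h
  levi-cong g≈h i j = cong₂ _*_ (χ-cong g≈h) (cofactor-cong (block-cong g≈h) i j)

  levi-⊗₃ : ∀ g h → ParabolicShape g → ParabolicShape h → levi (g ⊗₃ h) ≈M (levi g ⊗₂ levi h)
  levi-⊗₃ g h shape-g shape-h i j = begin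
    χ (g ⊗₃ h) * cofactor (block (g ⊗₃ h)) i j
      ≡⟨ cong₂ _*_ (χ-⊗₃ g h shape-g) (cofactor-cong (block-⊗₃ g h shape-h) i j) ⟩
    (χ g * χ h) * cofactor (block g ⊗₂ block h) i j
      ≡⟨ cong ((χ g * χ h) *_) (cofactor-⊗₂ (block g) (block h) i j) ⟩
    (χ g * χ h) * (cofactor (block g) ⊗₂ cofactor (block h)) i j
      ≡⟨ ·₂-⊗₂ (χ g) (χ h) (cofactor (block g)) (cofactor (block h)) i j ⟩
    (levi g ⊗₂ levi h) i j ∎

  det₂-levi : ∀ g → ParabolicShape g → det₃ g ≡ + 1 → det₂ (levi g) ≡ χ g
  det₂-levi g shape det≡1 = begin
    det₂ (χ g ·₂ cofactor (block g))   ≡⟨ det₂-·₂ (χ g) (cofactor (block g)) ⟩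
    (χ g * χ g) * det₂ (cofactor (block g))
      ≡⟨ cong₂ _*_ (unit-square (proj₂ χ-facts)) (trans (det₂-cofactor (block g)) (sym (proj₁ χ-facts))) ⟩
    + 1 * χ g                          ≡⟨ ℤP.*-identityˡ (χ g) ⟩
    χ g                                ∎
    where
    χ-facts : χ g ≡ det₂ (block g) × IsUnit (χ g)
    χ-facts = χ-unit g shape det≡1

  -- Membership in U for g ∈ P: trivial action on the plane (block = I) and on the quotient by it (χ = 1).
  Unipotent : Mat 3 → Set
  Unipotent g = ParabolicShape g × χ g ≡ + 1 × block g ≈M I₂

  det₃-unipotent : ∀ g → Unipotent g → det₃ g ≡ + 1
  det₃-unipotent g (shape , χ≡1 , block≈I) =
    trans (det₃-shape g shape) (cong₂ _*_ χ≡1 (det₂-cong block≈I))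

  levi-unipotent : ∀ g → Unipotent g → levi g ≈M I₂
  levi-unipotent g (_ , χ≡1 , block≈I) i j = begin
    χ g * cofactor (block g) i j  ≡⟨ cong₂ _*_ χ≡1 (cofactor-cong block≈I i j) ⟩
    + 1 * cofactor I₂ i j         ≡⟨ ℤP.*-identityˡ (cofactor I₂ i j) ⟩
    cofactor I₂ i j               ≡⟨ cofactor-I₂ i j ⟩
    I₂ i j                        ∎

  levi≈I⇒unipotent : ∀ g → ParabolicShape g → det₃ g ≡ + 1 → levi g ≈M I₂ → Unipotent g
  levi≈I⇒unipotent g shape det≡1 levi≈I = shape , χ≡1 , block≈I
    where
    χ≡1 : χ g ≡ + 1
    χ≡1 = trans (sym (det₂-levi g shape det≡1)) (det₂-cong levi≈I)
    cofactor≈I : cofactor (block g) ≈M I₂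
    cofactor≈I i j = begin
      cofactor (block g) i j        ≡⟨ ℤP.*-identityˡ (cofactor (block g) i j) ⟨
      + 1 * cofactor (block g) i j  ≡⟨ cong (_* cofactor (block g) i j) χ≡1 ⟨
      levi g i j                    ≡⟨ levi≈I i j ⟩
      I₂ i j                        ∎
    block≈I : block g ≈M I₂
    block≈I i j = begin
      block g i j                       ≡⟨ cofactor-involutive (block g) i j ⟨
      cofactor (cofactor (block g)) i j ≡⟨ cofactor-cong cofactor≈I i j ⟩
      cofactor I₂ i j                   ≡⟨ cofactor-I₂ i j ⟩
      I₂ i j                            ∎

  -- transvection α β = I + u ᵗv with u = direction α β; note v · u = 0.
  direction : ℤ → ℤ → Vec3
  direction α β = vec3 α (- (D * α)) β

  transvection : ℤ → ℤ → Mat 3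
  transvection α β zero zero = + 1 + D * α
  transvection α β zero (suc zero) = α
  transvection α β zero (suc (suc zero)) = + 0
  transvection α β (suc zero) zero = - (D * (D * α))
  transvection α β (suc zero) (suc zero) = + 1 - D * α
  transvection α β (suc zero) (suc (suc zero)) = + 0
  transvection α β (suc (suc zero)) zero = D * β
  transvection α β (suc (suc zero)) (suc zero) = β
  transvection α β (suc (suc zero)) (suc (suc zero)) = + 1

  transvection-unipotent : ∀ α β → Unipotent (transvection α β)
  transvection-unipotent α β = (g₁₀≡ , sym (cong -_ (ℤP.*-zeroʳ D))) , χ≡1 , block≈I
    where
    g₁₀≡ : - (D * (D * α)) ≡ D * (D * α + (+ 1 - D * α) - (+ 1 + D * α))
    g₁₀≡ = solve (D ∷ α ∷ [])
    χ≡1 : D * α + (+ 1 - D * α) ≡ + 1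
    χ≡1 = solve (D ∷ α ∷ [])
    block≈I : block (transvection α β) ≈M I₂
    block≈I zero zero = m+n-n≡m (+ 1) (D * α)
    block≈I zero (suc zero) = refl
    block≈I (suc zero) zero = ℤP.+-inverseʳ (D * β)
    block≈I (suc zero) (suc zero) = refl

  unipotent⇒≈transvection : ∀ g → Unipotent g → g ≈M transvection (g f0 f1) (g f2 f1)
  unipotent⇒≈transvection g ((g₁₀≡ , g₁₂≡) , χ≡1 , block≈I) = entry
    where
    g₀₀≡ : g f0 f0 ≡ + 1 + D * g f0 f1
    g₀₀≡ = m-n≡o⇒m≡o+n (block≈I g0 g0)
    collapse : ∀ α → D * (+ 1 - (+ 1 + D * α)) ≡ - (D * (D * α))
    collapse α = solve (D ∷ α ∷ [])
    entry : g ≈M transvection (g f0 f1) (g f2 f1)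
    entry zero zero = g₀₀≡
    entry zero (suc zero) = refl
    entry zero (suc (suc zero)) = block≈I g0 g1
    entry (suc zero) zero =
      trans g₁₀≡ (trans (cong₂ (λ c a → D * (c - a)) χ≡1 g₀₀≡) (collapse (g f0 f1)))
    entry (suc zero) (suc zero) = m+n≡o⇒n≡o-m {m = D * g f0 f1} χ≡1
    entry (suc zero) (suc (suc zero)) =
      trans g₁₂≡ (trans (cong (λ c → - (D * c)) (block≈I g0 g1)) (cong -_ (ℤP.*-zeroʳ D)))
    entry (suc (suc zero)) zero = trans (m-n≡o⇒m≡o+n (block≈I g1 g0)) (ℤP.+-identityˡ (D * g f2 f1))
    entry (suc (suc zero)) (suc zero) = refl
    entry (suc (suc zero)) (suc (suc zero)) = block≈I g1 g1

  transvection-+ : ∀ α β α′ β′ → transvection (α + α′) (β + β′) ≈M (transvection α β ⊗₃ transvection α′ β′)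
  transvection-+ α β α′ β′ = entry
    where
    entry : transvection (α + α′) (β + β′) ≈M (transvection α β ⊗₃ transvection α′ β′)
    entry zero zero = e
      where
      e : + 1 + D * (α + α′) ≡ (+ 1 + D * α) * (+ 1 + D * α′) + α * (- (D * (D * α′))) + + 0 * (D * β′)
      e = solve (D ∷ α ∷ α′ ∷ β′ ∷ [])
    entry zero (suc zero) = e
      where
      e : α + α′ ≡ (+ 1 + D * α) * α′ + α * (+ 1 - D * α′) + + 0 * β′
      e = solve (D ∷ α ∷ α′ ∷ β′ ∷ [])
    entry zero (suc (suc zero)) = e
      where
      e : + 0 ≡ (+ 1 + D * α) * + 0 + α * + 0 + + 0 * + 1
      e = solve (D ∷ α ∷ [])
    entry (suc zero) zero = e
      where
      e : - (D * (D * (α + α′))) ≡ - (D * (D * α)) * (+ 1 + D * α′) + (+ 1 - D * α) * - (D * (D * α′)) + + 0 * (D * β′)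
      e = solve (D ∷ α ∷ α′ ∷ β′ ∷ [])
    entry (suc zero) (suc zero) = e
      where
      e : + 1 - D * (α + α′) ≡ - (D * (D * α)) * α′ + (+ 1 - D * α) * (+ 1 - D * α′) + + 0 * β′
      e = solve (D ∷ α ∷ α′ ∷ β′ ∷ [])
    entry (suc zero) (suc (suc zero)) = e
      where
      e : + 0 ≡ - (D * (D * α)) * + 0 + (+ 1 - D * α) * + 0 + + 0 * + 1
      e = solve (D ∷ α ∷ [])
    entry (suc (suc zero)) zero = e
      where
      e : D * (β + β′) ≡ D * β * (+ 1 + D * α′) + β * - (D * (D * α′)) + + 1 * (D * β′)
      e = solve (D ∷ β ∷ α′ ∷ β′ ∷ [])
    entry (suc (suc zero)) (suc zero) = e
      where
      e : β + β′ ≡ D * β * α′ + β * (+ 1 - D * α′) + + 1 * β′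
      e = solve (D ∷ β ∷ α′ ∷ β′ ∷ [])
    entry (suc (suc zero)) (suc (suc zero)) = e
      where
      e : + 1 ≡ D * β * + 0 + β * + 0 + + 1 * + 1
      e = solve (D ∷ β ∷ [])

  lift : ℤ → Mat 2 → ℤ → ℤ → Mat 3
  lift c A x y zero zero = A g0 g0 + D * x
  lift c A x y zero (suc zero) = x
  lift c A x y zero (suc (suc zero)) = A g0 g1
  lift c A x y (suc zero) zero = D * (D * x + (c - D * x) - (A g0 g0 + D * x))
  lift c A x y (suc zero) (suc zero) = c - D * x
  lift c A x y (suc zero) (suc (suc zero)) = - (D * A g0 g1)
  lift c A x y (suc (suc zero)) zero = A g1 g0 + D * y
  lift c A x y (suc (suc zero)) (suc zero) = y
  lift c A x y (suc (suc zero)) (suc (suc zero)) = A g1 g1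

  lift-facts : ∀ c A x y → ParabolicShape (lift c A x y) × χ (lift c A x y) ≡ c × block (lift c A x y) ≈M A
  lift-facts c A x y = (refl , refl) , χ≡c , block≈A
    where
    χ≡c : D * x + (c - D * x) ≡ c
    χ≡c = solve (D ∷ x ∷ c ∷ [])
    block≈A : block (lift c A x y) ≈M A
    block≈A zero zero = m+n-n≡m (A g0 g0) (D * x)
    block≈A zero (suc zero) = refl
    block≈A (suc zero) zero = m+n-n≡m (A g1 g0) (D * y)
    block≈A (suc zero) (suc zero) = refl

  -- Its block is the inverse transpose of k, so levi maps it back to k.
  preimage : Mat 2 → ℤ → ℤ → Mat 3
  preimage k = lift (det₂ (transpose k)) (det₂ (transpose k) ·₂ cofactor k)

  preimage-facts : ∀ k x y → IsUnit (det₂ (transpose k)) →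
                   ParabolicShape (preimage k x y) × det₃ (preimage k x y) ≡ + 1 × levi (preimage k x y) ≈M k
  preimage-facts k x y ε-unit = shape , det≡1 , levi≈k
    where
    ε : ℤ
    ε = det₂ (transpose k)
    g : Mat 3
    g = preimage k x y
    shape : ParabolicShape g
    shape = proj₁ (lift-facts ε (ε ·₂ cofactor k) x y)
    χ≡ε : χ g ≡ ε
    χ≡ε = proj₁ (proj₂ (lift-facts ε (ε ·₂ cofactor k) x y))
    block≈A : block g ≈M (ε ·₂ cofactor k)
    block≈A = proj₂ (proj₂ (lift-facts ε (ε ·₂ cofactor k) x y))
    ε² : ε * ε ≡ + 1
    ε² = unit-square ε-unit
    det≡1 : det₃ g ≡ + 1
    det≡1 = begin
      det₃ g                                  ≡⟨ det₃-shape g shape ⟩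
      χ g * det₂ (block g)                    ≡⟨ cong₂ _*_ χ≡ε (det₂-cong block≈A) ⟩
      ε * det₂ (ε ·₂ cofactor k)              ≡⟨ cong (ε *_) (det₂-·₂ ε (cofactor k)) ⟩
      ε * ((ε * ε) * det₂ (cofactor k))       ≡⟨ cong (λ t → ε * (t * det₂ (cofactor k))) ε² ⟩
      ε * (+ 1 * det₂ (cofactor k))           ≡⟨ cong (ε *_) (ℤP.*-identityˡ (det₂ (cofactor k))) ⟩
      ε * det₂ (cofactor k)                   ≡⟨ cong (ε *_) (trans (det₂-cofactor k) (sym (det₂-transpose k))) ⟩
      ε * ε                                   ≡⟨ ε² ⟩
      + 1                                     ∎
    levi≈k : levi g ≈M k
    levi≈k i j = begin
      χ g * cofactor (block g) i j                   ≡⟨ cong₂ _*_ χ≡ε (cofactor-cong block≈A i j) ⟩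
      ε * cofactor (ε ·₂ cofactor k) i j             ≡⟨ cong (ε *_) (cofactor-·₂ ε (cofactor k) i j) ⟩
      ε * (ε * cofactor (cofactor k) i j)            ≡⟨ unit-·₂-·₂ {ε} ε² (cofactor (cofactor k)) i j ⟩
      cofactor (cofactor k) i j                      ≡⟨ cofactor-involutive k i j ⟩
      k i j                                          ∎

module ParabolicSubgroup (d : ℕ) where
  open Parabolic (+ d) public

  vd≡toℚ∘v : ∀ i → vd d i ≡ toℚ (v i)
  vd≡toℚ∘v zero = refl
  vd≡toℚ∘v (suc zero) = refl
  vd≡toℚ∘v (suc (suc zero)) = refl

  inW-toℚ : ∀ u → v · u ≡ + 0 → inW d (toℚ ∘ u)
  inW-toℚ u v·u≡0 = trans (sym (toℚ-· v u)) (cong toℚ v·u≡0)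

  inW-toℚ⁻ : ∀ u → inW d (toℚ ∘ u) → v · u ≡ + 0
  inW-toℚ⁻ u u∈W = toℚ-injective (trans (toℚ-· v u) u∈W)

  inW-cong : ∀ {x y : Vec3ℚ} → (∀ i → x i ≡ y i) → inW d x → inW d y
  inW-cong {x} {y} x≡y x∈W = trans (sym (cong₂ ℚ._+_ (cong₂ ℚ._+_ (term f0) (term f1)) (term f2))) x∈W
    where
    term : ∀ i → vd d i ℚ.* x i ≡ vd d i ℚ.* y i
    term i = cong (vd d i ℚ.*_) (x≡y i)

  inP⇒shape : ∀ g → inP d g → ParabolicShape g
  inP⇒shape g (_ , c , ᵗg·v≡cv) = eigen⇒shape g (λ i → trans (integral i) (cong (_* v i) (transpose-column₁ g)))
    where
    integral : ∀ i → transpose g i · v ≡ transpose g f1 · v * v i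
    integral = proportional⇒integral-multiple (λ i → transpose g i · v) v c refl
      (λ i → trans (sym (act-toℚ (transpose g) v i)) (trans (ᵗg·v≡cv i) (cong (c ℚ.*_) (vd≡toℚ∘v i))))

  shape⇒inP : ∀ g → det₃ g ≡ + 1 → ParabolicShape g → inP d g
  shape⇒inP g det≡1 shape = det≡1 , toℚ (χ g) , λ i → begin
    act (transpose g) (vd d) i  ≡⟨ act-toℚ (transpose g) v i ⟩
    toℚ (transpose g i · v)     ≡⟨ cong toℚ (shape⇒eigen g shape i) ⟩
    toℚ (χ g * v i)             ≡⟨ toℚ-* (χ g) (v i) ⟩
    toℚ (χ g) ℚ.* toℚ (v i)     ≡⟨ cong (toℚ (χ g) ℚ.*_) (vd≡toℚ∘v i) ⟨
    toℚ (χ g) ℚ.* vd d i        ∎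

  pairing : Vec3ℚ → ℚ
  pairing x = vd d f0 ℚ.* x f0 ℚ.+ vd d f1 ℚ.* x f1 ℚ.+ vd d f2 ℚ.* x f2

  act-transvection : ∀ α β x i → act (transvection α β) x i ≡ x i ℚ.+ toℚ (direction α β i) ℚ.* pairing x
  act-transvection α β x = row
    where
    open +-*-Solver using (con; _:+_; _:*_; _:-_; :-_; _:=_) renaming (solve to solveℚ)
    a b δ : ℚ
    a = toℚ α
    b = toℚ β
    δ = toℚ (+ d)
    toℚ-Dα : toℚ (+ d * α) ≡ δ ℚ.* a
    toℚ-Dα = toℚ-* (+ d) α
    row : ∀ i → act (transvection α β) x i ≡ x i ℚ.+ toℚ (direction α β i) ℚ.* pairing x
    row zero = begin
      toℚ (+ 1 + + d * α) ℚ.* x f0 ℚ.+ a ℚ.* x f1 ℚ.+ 0ℚ ℚ.* x f2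
        ≡⟨ cong (λ t → t ℚ.* x f0 ℚ.+ a ℚ.* x f1 ℚ.+ 0ℚ ℚ.* x f2) (trans (toℚ-+ (+ 1) (+ d * α)) (cong (1ℚ ℚ.+_) toℚ-Dα)) ⟩
      (1ℚ ℚ.+ δ ℚ.* a) ℚ.* x f0 ℚ.+ a ℚ.* x f1 ℚ.+ 0ℚ ℚ.* x f2
        ≡⟨ solveℚ 5 (λ a δ x₀ x₁ x₂ → (con 1ℚ :+ δ :* a) :* x₀ :+ a :* x₁ :+ con 0ℚ :* x₂
                                   := x₀ :+ a :* (δ :* x₀ :+ con 1ℚ :* x₁ :+ con 0ℚ :* x₂)) refl a δ (x f0) (x f1) (x f2) ⟩
      x f0 ℚ.+ a ℚ.* pairing x ∎
    row (suc zero) = begin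
      toℚ (- (+ d * (+ d * α))) ℚ.* x f0 ℚ.+ toℚ (+ 1 - + d * α) ℚ.* x f1 ℚ.+ 0ℚ ℚ.* x f2
        ≡⟨ cong₂ (λ s t → s ℚ.* x f0 ℚ.+ t ℚ.* x f1 ℚ.+ 0ℚ ℚ.* x f2)
             (trans (toℚ-neg (+ d * (+ d * α))) (cong ℚ.-_ (trans (toℚ-* (+ d) (+ d * α)) (cong (δ ℚ.*_) toℚ-Dα))))
             (trans (toℚ-- (+ 1) (+ d * α)) (cong (ℚ._-_ 1ℚ) toℚ-Dα)) ⟩
      (ℚ.- (δ ℚ.* (δ ℚ.* a))) ℚ.* x f0 ℚ.+ (1ℚ ℚ.- δ ℚ.* a) ℚ.* x f1 ℚ.+ 0ℚ ℚ.* x f2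
        ≡⟨ solveℚ 5 (λ a δ x₀ x₁ x₂ → (:- (δ :* (δ :* a))) :* x₀ :+ (con 1ℚ :- δ :* a) :* x₁ :+ con 0ℚ :* x₂
                                   := x₁ :+ (:- (δ :* a)) :* (δ :* x₀ :+ con 1ℚ :* x₁ :+ con 0ℚ :* x₂)) refl a δ (x f0) (x f1) (x f2) ⟩
      x f1 ℚ.+ (ℚ.- (δ ℚ.* a)) ℚ.* pairing x
        ≡⟨ cong (λ t → x f1 ℚ.+ t ℚ.* pairing x) (trans (toℚ-neg (+ d * α)) (cong ℚ.-_ toℚ-Dα)) ⟨
      x f1 ℚ.+ toℚ (- (+ d * α)) ℚ.* pairing x ∎
    row (suc (suc zero)) = begin
      toℚ (+ d * β) ℚ.* x f0 ℚ.+ b ℚ.* x f1 ℚ.+ 1ℚ ℚ.* x f2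
        ≡⟨ cong (λ t → t ℚ.* x f0 ℚ.+ b ℚ.* x f1 ℚ.+ 1ℚ ℚ.* x f2) (toℚ-* (+ d) β) ⟩
      (δ ℚ.* b) ℚ.* x f0 ℚ.+ b ℚ.* x f1 ℚ.+ 1ℚ ℚ.* x f2
        ≡⟨ solveℚ 5 (λ b δ x₀ x₁ x₂ → (δ :* b) :* x₀ :+ b :* x₁ :+ con 1ℚ :* x₂
                                   := x₂ :+ b :* (δ :* x₀ :+ con 1ℚ :* x₁ :+ con 0ℚ :* x₂)) refl b δ (x f0) (x f1) (x f2) ⟩
      x f2 ℚ.+ b ℚ.* pairing x ∎

  transvection-fixes-W : ∀ α β w → inW d w → ∀ i → act (transvection α β) w i ≡ w i
  transvection-fixes-W α β w w∈W i = begin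
    act (transvection α β) w i                       ≡⟨ act-transvection α β w i ⟩
    w i ℚ.+ toℚ (direction α β i) ℚ.* pairing w      ≡⟨ cong (λ s → w i ℚ.+ toℚ (direction α β i) ℚ.* s) w∈W ⟩
    w i ℚ.+ toℚ (direction α β i) ℚ.* 0ℚ             ≡⟨ cong (w i ℚ.+_) (ℚP.*-zeroʳ (toℚ (direction α β i))) ⟩
    w i ℚ.+ 0ℚ                                       ≡⟨ ℚP.+-identityʳ (w i) ⟩
    w i                                              ∎

  transvection-trivial-on-quotient : ∀ α β x → inW d (λ i → act (transvection α β) x i ℚ.- x i)
  transvection-trivial-on-quotient α β x =
    inW-cong (λ i → cong (ℚ._- x i) (sym (act-transvection α β x i))) (begin
      δ ℚ.* ((x f0 ℚ.+ a ℚ.* s) ℚ.- x f0)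
        ℚ.+ 1ℚ ℚ.* ((x f1 ℚ.+ toℚ (- (+ d * α)) ℚ.* s) ℚ.- x f1)
        ℚ.+ 0ℚ ℚ.* ((x f2 ℚ.+ b ℚ.* s) ℚ.- x f2)
          ≡⟨ cong (λ t → δ ℚ.* ((x f0 ℚ.+ a ℚ.* s) ℚ.- x f0) ℚ.+ 1ℚ ℚ.* ((x f1 ℚ.+ t ℚ.* s) ℚ.- x f1)
                         ℚ.+ 0ℚ ℚ.* ((x f2 ℚ.+ b ℚ.* s) ℚ.- x f2))
                  (trans (toℚ-neg (+ d * α)) (cong ℚ.-_ (toℚ-* (+ d) α))) ⟩
      δ ℚ.* ((x f0 ℚ.+ a ℚ.* s) ℚ.- x f0)
        ℚ.+ 1ℚ ℚ.* ((x f1 ℚ.+ (ℚ.- (δ ℚ.* a)) ℚ.* s) ℚ.- x f1)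
        ℚ.+ 0ℚ ℚ.* ((x f2 ℚ.+ b ℚ.* s) ℚ.- x f2)
          ≡⟨ solveℚ 7 (λ a b δ s x₀ x₁ x₂ →
                 δ :* ((x₀ :+ a :* s) :- x₀) :+ con 1ℚ :* ((x₁ :+ (:- (δ :* a)) :* s) :- x₁)
                   :+ con 0ℚ :* ((x₂ :+ b :* s) :- x₂) := con 0ℚ) refl a b δ s (x f0) (x f1) (x f2) ⟩
      0ℚ ∎)
    where
    open +-*-Solver using (con; _:+_; _:*_; _:-_; :-_; _:=_) renaming (solve to solveℚ)
    a b δ s : ℚ
    a = toℚ α
    b = toℚ β
    δ = toℚ (+ d)
    s = pairing x

  inU-≈transvection : ∀ g α β → inP d g → g ≈M transvection α β → inU d g
  inU-≈transvection g α β g∈P g≈R = g∈P , fixes-W , trivial-on-quotient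
    where
    fixes-W : ∀ w → inW d w → ∀ i → act g w i ≡ w i
    fixes-W w w∈W i = trans (act-cong g≈R w i) (transvection-fixes-W α β w w∈W i)
    trivial-on-quotient : ∀ x → inW d (λ i → act g x i ℚ.- x i)
    trivial-on-quotient x =
      inW-cong (λ i → cong (ℚ._- x i) (sym (act-cong g≈R x i))) (transvection-trivial-on-quotient α β x)

  transvection-inU : ∀ α β → inU d (transvection α β)
  transvection-inU α β = inU-≈transvection (transvection α β) α β
    (shape⇒inP (transvection α β) (det₃-unipotent _ unipotent) (proj₁ unipotent)) (λ _ _ → refl)
    where
    unipotent : Unipotent (transvection α β)
    unipotent = transvection-unipotent α β

  inU⇒unipotent : ∀ g → inU d g → Unipotent g
  inU⇒unipotent g (g∈P , fixes-W , trivial-on-quotient) = inP⇒shape g g∈P , χ≡1 , block≈I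
    where
    fixes : ∀ u → v · u ≡ + 0 → ∀ i → g i · u ≡ u i
    fixes u v·u≡0 i = toℚ-injective (trans (sym (act-toℚ g u i)) (fixes-W (toℚ ∘ u) (inW-toℚ u v·u≡0) i))
    block≈I : block g ≈M I₂
    block≈I zero zero = trans (sym (proj₁ (proj₁ (block-columns g)))) (fixes w₁ v·w₁≡0 f0)
    block≈I zero (suc zero) = trans (sym (proj₁ (proj₂ (block-columns g)))) (fixes w₂ v·w₂≡0 f0)
    block≈I (suc zero) zero = trans (sym (proj₂ (proj₁ (block-columns g)))) (fixes w₁ v·w₁≡0 f2)
    block≈I (suc zero) (suc zero) = trans (sym (proj₂ (proj₂ (block-columns g)))) (fixes w₂ v·w₂≡0 f2)
    displacement : ∀ i → act g (toℚ ∘ e₂) i ℚ.- toℚ (e₂ i) ≡ toℚ (g i f1 - e₂ i)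
    displacement i = trans (cong (ℚ._- toℚ (e₂ i)) (trans (act-toℚ g e₂ i) (cong toℚ (·e₂ (g i)))))
                           (sym (toℚ-- (g i f1) (e₂ i)))
    χ≡1 : χ g ≡ + 1
    χ≡1 = v·[ge₂-e₂]≡0⇒χ≡1 g (inW-toℚ⁻ (λ i → g i f1 - e₂ i) (inW-cong displacement (trivial-on-quotient (toℚ ∘ e₂))))

module Congruence (N d : ℕ) .{{_ : NonZero d}} (N>0 : 0 < N) (d∣N : d ∣ N) where
  open ParabolicSubgroup d

  M Δ : ℕ
  M = N / d
  Δ = gcd d M

  instance
    N≢0 : NonZero N
    N≢0 = ℕ.>-nonZero N>0
    M≢0 : NonZero M
    M≢0 = ℕ.>-nonZero (m≥n⇒m/n>0 (ℕD.∣⇒≤ d∣N))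
    gcd[N,d²]≢0 : NonZero (gcd N (d ℕ.* d))
    gcd[N,d²]≢0 = ℕ.≢-nonZero (gcd[m,n]≢0 N (d ℕ.* d) (inj₁ (ℕ.≢-nonZero⁻¹ N)))

  A₀ : ℕ
  A₀ = N / gcd N (d ℕ.* d)

  instance
    A₀≢0 : NonZero A₀
    A₀≢0 = ℕ.≢-nonZero (m/gcd[m,n]≢0 N (d ℕ.* d))

  d*M≡N : + d * + M ≡ + N
  d*M≡N = trans (sym (ℤP.pos-* d M)) (cong +_ (m*[n/m]≡n d∣N))

  N∣dβ⇒M∣β : ∀ β → (+ N) ℤD.∣ (+ d * β) → (+ M) ∣ℤ β
  N∣dβ⇒M∣β β N∣dβ = ∣ᵤ⇒∣ (ℕD.*-cancelˡ-∣ d (subst₂ _∣_ (sym (m*[n/m]≡n d∣N)) (ℤP.abs-* (+ d) β) N∣dβ))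

  M∣β⇒N∣dβ : ∀ β → (+ M) ∣ℤ β → (+ N) ℤD.∣ (+ d * β)
  M∣β⇒N∣dβ β M∣β = subst₂ _∣_ (m*[n/m]≡n d∣N) (sym (ℤP.abs-* (+ d) β)) (ℕD.*-monoʳ-∣ d (∣⇒∣ᵤ M∣β))

  ∣-d²α∣ : ∀ α → ∣ - (+ d * (+ d * α)) ∣ ≡ d ℕ.* d ℕ.* ∣ α ∣
  ∣-d²α∣ α = begin
    ∣ - (+ d * (+ d * α)) ∣   ≡⟨ ℤP.∣-i∣≡∣i∣ (+ d * (+ d * α)) ⟩
    ∣ + d * (+ d * α) ∣       ≡⟨ ℤP.abs-* (+ d) (+ d * α) ⟩
    d ℕ.* ∣ + d * α ∣         ≡⟨ cong (d ℕ.*_) (ℤP.abs-* (+ d) α) ⟩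
    d ℕ.* (d ℕ.* ∣ α ∣)       ≡⟨ ℕP.*-assoc d d ∣ α ∣ ⟨
    d ℕ.* d ℕ.* ∣ α ∣         ∎

  N∣d²α⇒A₀∣α : ∀ α → (+ N) ℤD.∣ (- (+ d * (+ d * α))) → (+ A₀) ∣ℤ α
  N∣d²α⇒A₀∣α α N∣d²α = ∣ᵤ⇒∣ (∣m*a⇒n/gcd∣a N (d ℕ.* d) ∣ α ∣ (subst (N ∣_) (∣-d²α∣ α) N∣d²α))

  A₀∣α⇒N∣d²α : ∀ α → (+ A₀) ∣ℤ α → (+ N) ℤD.∣ (- (+ d * (+ d * α)))
  A₀∣α⇒N∣d²α α A₀∣α = subst (N ∣_) (sym (∣-d²α∣ α)) (n/gcd∣a⇒∣m*a N (d ℕ.* d) ∣ α ∣ (∣⇒∣ᵤ A₀∣α))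

  ι : ℤ × ℤ → Mat 3
  ι (k , m) = transvection (k * + A₀) (m * + M)

  ι-+ : ∀ k m k′ m′ → ι (k + k′ , m + m′) ≈M (ι (k , m) ⊗₃ ι (k′ , m′))
  ι-+ k m k′ m′ i j = trans
    (cong (λ R → R i j) (cong₂ transvection (ℤP.*-distribʳ-+ (+ A₀) k k′) (ℤP.*-distribʳ-+ (+ M) m m′)))
    (transvection-+ (k * + A₀) (m * + M) (k′ * + A₀) (m′ * + M) i j)

  ι-ΓU : ∀ a → ΓU N d (ι a)
  ι-ΓU (k , m) =
    ( det₃-unipotent (ι (k , m)) (transvection-unipotent (k * + A₀) (m * + M))
    , A₀∣α⇒N∣d²α (k * + A₀) (∣n⇒∣m*n k ∣-refl)
    , M∣β⇒N∣dβ (m * + M) (∣n⇒∣m*n m ∣-refl))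
    , transvection-inU (k * + A₀) (m * + M)

  ι-injective : ∀ a b → ι a ≈M ι b → a ≡ b
  ι-injective (k , m) (k′ , m′) ι≈ι =
    cong₂ _,_ (ℤP.*-cancelʳ-≡ k k′ (+ A₀) (ι≈ι f0 f1)) (ℤP.*-cancelʳ-≡ m m′ (+ M) (ι≈ι f2 f1))

  ι-surjective : ∀ g → ΓU N d g → ∃ λ a → ι a ≈M g
  ι-surjective g ((_ , N∣g₁₀ , N∣g₂₀) , g∈U) =
    fromQuotients (N∣d²α⇒A₀∣α α (subst ((+ N) ℤD.∣_) (g≈R f1 f0) N∣g₁₀))
                  (N∣dβ⇒M∣β β (subst ((+ N) ℤD.∣_) (g≈R f2 f0) N∣g₂₀))
    where
    α β : ℤ
    α = g f0 f1
    β = g f2 f1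
    g≈R : g ≈M transvection α β
    g≈R = unipotent⇒≈transvection g (inU⇒unipotent g g∈U)
    fromQuotients : (+ A₀) ∣ℤ α → (+ M) ∣ℤ β → ∃ λ a → ι a ≈M g
    fromQuotients (divides q α≡qA₀) (divides r β≡rM) = (q , r) , λ i j →
      trans (cong (λ R → R i j) (cong₂ transvection (sym α≡qA₀) (sym β≡rM))) (sym (g≈R i j))

  ΓU≅ℤ² : GammaU≅ℤ² N d
  ΓU≅ℤ² = ι , (λ a b → ι-+ (proj₁ a) (proj₂ a) (proj₁ b) (proj₂ b)) , ι-ΓU , ι-injective , ι-surjective

  Δ∣d : (+ Δ) ∣ℤ (+ d)
  Δ∣d = ∣ᵤ⇒∣ (gcd[m,n]∣m d M)

  Δ∣M : (+ Δ) ∣ℤ (+ M)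
  Δ∣M = ∣ᵤ⇒∣ (gcd[m,n]∣n d M)

  levi-∈ᵗΓ₁* : ∀ g → ΓP N d g → tΓ₁* d Δ (levi g)
  levi-∈ᵗΓ₁* g ((det≡1 , N∣g₁₀ , N∣g₂₀) , g∈P) = subst IsUnit (sym det-levi) (proj₂ χ-facts) , d∣levi₀₁ , Δ∣levi₀₀-det
    where
    shape : ParabolicShape g
    shape = inP⇒shape g g∈P
    χ-facts : χ g ≡ det₂ (block g) × IsUnit (χ g)
    χ-facts = χ-unit g shape det≡1
    det-levi : det₂ (transpose (levi g)) ≡ χ g
    det-levi = trans (det₂-transpose (levi g)) (det₂-levi g shape det≡1)
    d∣g₂₀ : (+ d) ∣ℤ g f2 f0
    d∣g₂₀ = ∣-trans (∣ᵤ⇒∣ {+ d} {+ N} d∣N) (∣ᵤ⇒∣ {+ N} {g f2 f0} N∣g₂₀)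
    d∣levi₀₁ : (+ d) ℤD.∣ levi g g0 g1
    d∣levi₀₁ = ∣⇒∣ᵤ (∣n⇒∣m*n (χ g) (∣m⇒∣-m (∣m∣n⇒∣m-n d∣g₂₀ (∣m⇒∣m*n (g f2 f1) ∣-refl))))
    Δ∣χ-g₀₀ : (+ Δ) ∣ℤ (χ g - g f0 f0)
    Δ∣χ-g₀₀ = ∣-trans Δ∣M (N∣dβ⇒M∣β (χ g - g f0 f0) (subst ((+ N) ℤD.∣_) (proj₁ shape) N∣g₁₀))
    Δ∣levi₀₀-det : (+ Δ) ℤD.∣ (levi g g0 g0 - det₂ (transpose (levi g)))
    Δ∣levi₀₀-det = ∣⇒∣ᵤ (subst ((+ Δ) ∣ℤ_)
      (sym (trans (cong (_-_ (χ g * g f2 f2)) (trans det-levi (proj₁ χ-facts))) (χg₂₂-det₂-block g)))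
      (∣m∣n⇒∣m+n (∣m∣n⇒∣m+n (∣m⇒∣m*n (g f2 f2) Δ∣χ-g₀₀) (∣m⇒∣m*n _ Δ∣d))
                 (∣n⇒∣m*n (g f0 f2) (∣-trans Δ∣d d∣g₂₀))))

  levi-surjective : ∀ k → tΓ₁* d Δ k → ∃ λ g → ΓP N d g × levi g ≈M k
  levi-surjective k (ε-unit , d∣k₀₁ , Δ∣k₀₀-ε) =
    fromWitnesses (∣ᵤ⇒∣ {+ d} {k g0 g1} d∣k₀₁) Δ∣ε-εk₁₁ (bézout d M)
    where
    ε : ℤ
    ε = det₂ (transpose k)
    ε-εk₁₁ : ∀ a b c e → (a * e - c * b) - (a * e - c * b) * e ≡ (a - (a * e - c * b)) * e - c * b
    ε-εk₁₁ a b c e = solve (a ∷ b ∷ c ∷ e ∷ [])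
    Δ∣ε-εk₁₁ : (+ Δ) ∣ℤ (ε - ε * k g1 g1)
    Δ∣ε-εk₁₁ = subst ((+ Δ) ∣ℤ_) (sym (ε-εk₁₁ (k g0 g0) (k g0 g1) (k g1 g0) (k g1 g1)))
      (∣m∣n⇒∣m-n (∣m⇒∣m*n (k g1 g1) (∣ᵤ⇒∣ {+ Δ} {k g0 g0 - ε} Δ∣k₀₀-ε))
                 (∣n⇒∣m*n (k g1 g0) (∣-trans Δ∣d (∣ᵤ⇒∣ {+ d} {k g0 g1} d∣k₀₁))))
    vanish₁₀ : ∀ D M ε c s u w → ε - c ≡ s * (u * D + w * M) →
               D * (D * (s * u) + (ε - D * (s * u)) - (c + D * (s * u))) ≡ (s * w) * (D * M)
    vanish₁₀ D M ε c s u w eq = ≡-by-difference (cong (D *_) eq) (solve (D ∷ M ∷ ε ∷ c ∷ s ∷ u ∷ w ∷ []))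
    vanish₂₀ : ∀ D ε r → ε * - (r * D) + D * (ε * r) ≡ + 0
    vanish₂₀ D ε r = solve (D ∷ ε ∷ r ∷ [])
    -- With Δ = u d + w M and ε - ε k₁₁ = s Δ, the free entries s u and ε r make g₁₀ = s w N and g₂₀ = 0.
    fromWitnesses : (+ d) ∣ℤ k g0 g1 → (+ Δ) ∣ℤ (ε - ε * k g1 g1) → (∃₂ λ u w → + Δ ≡ u * + d + w * + M) →
                    ∃ λ g → ΓP N d g × levi g ≈M k
    fromWitnesses (divides r k₀₁≡rd) (divides s ε-εk₁₁≡sΔ) (u , w , Δ≡ud+wM) =
      g , ((det≡1 , N∣g₁₀ , N∣g₂₀) , shape⇒inP g det≡1 shape) , levi≈k
      where
      g : Mat 3
      g = preimage k (s * u) (ε * r)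
      shape : ParabolicShape g
      shape = proj₁ (preimage-facts k (s * u) (ε * r) ε-unit)
      det≡1 : det₃ g ≡ + 1
      det≡1 = proj₁ (proj₂ (preimage-facts k (s * u) (ε * r) ε-unit))
      levi≈k : levi g ≈M k
      levi≈k = proj₂ (proj₂ (preimage-facts k (s * u) (ε * r) ε-unit))
      N∣g₁₀ : (+ N) ℤD.∣ g f1 f0
      N∣g₁₀ = ∣⇒∣ᵤ (divides (s * w) (trans
        (vanish₁₀ (+ d) (+ M) ε (ε * k g1 g1) s u w (trans ε-εk₁₁≡sΔ (cong (s *_) Δ≡ud+wM)))
        (cong ((s * w) *_) d*M≡N)))
      N∣g₂₀ : (+ N) ℤD.∣ g f2 f0
      N∣g₂₀ = subst ((+ N) ℤD.∣_)
        (sym (trans (cong (λ t → ε * - t + + d * (ε * r)) k₀₁≡rd) (vanish₂₀ (+ d) ε r))) (N ℕD.∣0)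

  levi-kernel : ∀ g → ΓP N d g → (levi g ≈M I₂ → ΓU N d g) × (ΓU N d g → levi g ≈M I₂)
  levi-kernel g (g∈Γ₀ , g∈P) = kernel⊆U , U⊆kernel
    where
    kernel⊆U : levi g ≈M I₂ → ΓU N d g
    kernel⊆U levi≈I = g∈Γ₀ , inU-≈transvection g (g f0 f1) (g f2 f1) g∈P
      (unipotent⇒≈transvection g (levi≈I⇒unipotent g (inP⇒shape g g∈P) (proj₁ g∈Γ₀) levi≈I))
    U⊆kernel : ΓU N d g → levi g ≈M I₂
    U⊆kernel (_ , g∈U) = levi-unipotent g (inU⇒unipotent g g∈U)

  ΓL≅ᵗΓ₁* : GammaL≅tΓ₁* N d Δ
  ΓL≅ᵗΓ₁* = levi
          , (λ g h _ → levi-cong)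
          , (λ g h g∈ΓP h∈ΓP → levi-⊗₃ g h (inP⇒shape g (proj₂ g∈ΓP)) (inP⇒shape h (proj₂ h∈ΓP)))
          , levi-∈ᵗΓ₁*
          , levi-surjective
          , levi-kernel

lemma6p6 : (N : ℕ) → 0 < N → (d : ℕ) → .{{_ : NonZero d}} → d ∣ N →
    GammaU≅ℤ² N d × GammaL≅tΓ₁* N d (gcd d (N / d))
lemma6p6 N N>0 d d∣N = Congruence.ΓU≅ℤ² N d N>0 d∣N , Congruence.ΓL≅ᵗΓ₁* N d N>0 d∣N
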